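{- For all integers $k \ge 2$, $$\sum_{n=0}^{k}(-1)^n\binom{k}{n}\Bigl\lfloor\frac{k-n}{2}\Bigr\rfloor = (-2)^{k-2}.$$ -}

module Defs where

open import Data.Nat using (ℕ; zero; suc; _∸_; _/_)
open import Data.Integer using (ℤ; +_; -_; _+_; _*_; _^_)
open import Data.Nat.Combinatorics using (_C_)

sumTo : ℕ → (ℕ → ℤ) → ℤ
sumTo zero    f = f 0
sumTo (suc m) f = sumTo m f + f (suc m)

-- (-1)^n * C(k,n) * ⌊(k-n)/2⌋ ; for 0 ≤ n ≤ k, k-n is a natural number,
-- so the floor is natural-number division.
term : ℕ → ℕ → ℤ
term k n = ((- + 1) ^ n) * (+ (k C n)) * (+ ((k ∸ n) / 2))

{-# OPTIONS --safe #-}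
-- The sum is the alternating binomial transform of g(m) = ⌊m/2⌋, and Pascal's rule shows that
-- the transform of order k is the k-th forward difference Δᵏg(0). Now Δ⌊m/2⌋ is the parity of
-- m, the difference of the parity is (-1)ᵐ, and Δ(-1)ᵐ = -2·(-1)ᵐ; hence Δᵏg(0) = (-2)ᵏ⁻².
module Submission where

open import Defs
open import Data.Nat using (ℕ; zero; suc; _≤_; _∸_; _/_; z≤n; s≤s)
open import Data.Nat.Properties using (≤-refl; m≤n⇒m≤1+n; n<1+n; +-∸-assoc)
open import Data.Nat.DivMod using (m/n≡1+[m∸n]/n)
open import Data.Nat.Combinatorics using (_C_; nCk+nC[k+1]≡[n+1]C[k+1]; k>n⇒nCk≡0)
open import Data.Integer using (ℤ; +_; -_; _^_; _+_; _*_; _-_)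
open import Data.Integer.Properties using (*-identityˡ; *-identityʳ; *-assoc; +-identityʳ; *-zeroʳ)
open import Data.Integer.Tactic.RingSolver using (solve-∀)
open import Relation.Binary.PropositionalEquality
open ≡-Reasoning

sumTo-cong : ∀ k {f g : ℕ → ℤ} → (∀ {n} → n ≤ k → f n ≡ g n) → sumTo k f ≡ sumTo k g
sumTo-cong zero    f≗g = f≗g z≤n
sumTo-cong (suc k) f≗g = cong₂ _+_ (sumTo-cong k (λ n≤k → f≗g (m≤n⇒m≤1+n n≤k))) (f≗g ≤-refl)

+[1+k]C[1+n] : ∀ k n → + (suc k C suc n) ≡ + (k C n) + + (k C suc n)
+[1+k]C[1+n] k n = cong +_ (sym (nCk+nC[k+1]≡[n+1]C[k+1] k n))

sumTo-pascal : ∀ k j (c : ℕ → ℤ) →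
  sumTo (suc j) (λ n → c n * + (suc k C n)) ≡
  sumTo j (λ n → (c n + c (suc n)) * + (k C n)) + c (suc j) * + (k C suc j)
sumTo-pascal k zero c = begin
  c 0 * + 1 + c 1 * + (suc k C 1)       ≡⟨ cong (λ x → c 0 * + 1 + c 1 * x) (+[1+k]C[1+n] k 0) ⟩
  c 0 * + 1 + c 1 * (+ 1 + + (k C 1))   ≡⟨ regroup (c 0) (c 1) (+ (k C 1)) ⟩
  (c 0 + c 1) * + 1 + c 1 * + (k C 1)   ∎
  where
  regroup : ∀ a b x → a * + 1 + b * (+ 1 + x) ≡ (a + b) * + 1 + b * x
  regroup = solve-∀
sumTo-pascal k (suc j) c = begin
  sumTo (suc j) (λ n → c n * + (suc k C n)) + c (2+j) * + (suc k C 2+j)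
    ≡⟨ cong₂ _+_ (sumTo-pascal k j c) (cong (c (2+j) *_) (+[1+k]C[1+n] k (suc j))) ⟩
  S + c (suc j) * + (k C suc j) + c (2+j) * (+ (k C suc j) + + (k C 2+j))
    ≡⟨ regroup S (c (suc j)) (c (2+j)) (+ (k C suc j)) (+ (k C 2+j)) ⟩
  S + (c (suc j) + c (2+j)) * + (k C suc j) + c (2+j) * + (k C 2+j)
    ∎
  where
  2+j = suc (suc j)
  S = sumTo j (λ n → (c n + c (suc n)) * + (k C n))
  regroup : ∀ S a b x y → S + a * x + b * (x + y) ≡ S + (a + b) * x + b * y
  regroup = solve-∀

sign : ℕ → ℤ
sign n = (- + 1) ^ n

alternatingBinomialSum : ℕ → (ℕ → ℤ) → ℤ
alternatingBinomialSum k g = sumTo k (λ n → sign n * + (k C n) * g (k ∸ n))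

Δ : (ℕ → ℤ) → ℕ → ℤ
Δ g m = g (suc m) - g m

Δ^ : ℕ → (ℕ → ℤ) → ℕ → ℤ
Δ^ zero    g = g
Δ^ (suc k) g = Δ^ k (Δ g)

alternatingBinomialSum-suc : ∀ k g → alternatingBinomialSum (suc k) g ≡ alternatingBinomialSum k (Δ g)
alternatingBinomialSum-suc k g = begin
  alternatingBinomialSum (suc k) g
    ≡⟨ sumTo-cong (suc k) (λ {n} _ → swap (sign n) _ _) ⟩
  sumTo (suc k) (λ n → c n * + (suc k C n))
    ≡⟨ sumTo-pascal k k c ⟩
  S + c (suc k) * + (k C suc k)
    ≡⟨ cong (λ x → S + c (suc k) * + x) (k>n⇒nCk≡0 (n<1+n k)) ⟩
  S + c (suc k) * + 0
    ≡⟨ cong (_+_ S) (*-zeroʳ (c (suc k))) ⟩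
  S + + 0
    ≡⟨ +-identityʳ S ⟩
  S
    ≡⟨ sumTo-cong k collect ⟩
  alternatingBinomialSum k (Δ g)
    ∎
  where
  c : ℕ → ℤ
  c n = sign n * g (suc k ∸ n)
  S = sumTo k (λ n → (c n + c (suc n)) * + (k C n))
  swap : ∀ s x y → s * x * y ≡ s * y * x
  swap = solve-∀
  collect : ∀ {n} → n ≤ k → (c n + c (suc n)) * + (k C n) ≡ sign n * + (k C n) * Δ g (k ∸ n)
  collect {n} n≤k rewrite +-∸-assoc 1 n≤k = factor (sign n) (g (suc (k ∸ n))) (g (k ∸ n)) (+ (k C n))
    where
    factor : ∀ s a b x → (s * a + (- + 1 * s) * b) * x ≡ s * x * (a - b)
    factor = solve-∀

alternatingBinomialSum≡Δ^ : ∀ k g → alternatingBinomialSum k g ≡ Δ^ k g 0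
alternatingBinomialSum≡Δ^ zero    g = *-identityˡ (g 0)
alternatingBinomialSum≡Δ^ (suc k) g =
  trans (alternatingBinomialSum-suc k g) (alternatingBinomialSum≡Δ^ k (Δ g))

Δ^-cong : ∀ k {g h : ℕ → ℤ} → (∀ m → g m ≡ h m) → ∀ m → Δ^ k g m ≡ Δ^ k h m
Δ^-cong zero    g≗h = g≗h
Δ^-cong (suc k) g≗h = Δ^-cong k (λ m → cong₂ _-_ (g≗h (suc m)) (g≗h m))

Δ^-scale : ∀ k a g m → Δ^ k (λ m → a * g m) m ≡ a * Δ^ k g m
Δ^-scale zero    a g m = refl
Δ^-scale (suc k) a g m = trans (Δ^-cong k (λ m → distrib a (g (suc m)) (g m)) m) (Δ^-scale k a (Δ g) m)
  where
  distrib : ∀ a x y → a * x - a * y ≡ a * (x - y)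
  distrib = solve-∀

Δsign : ∀ m → Δ sign m ≡ - + 2 * sign m
Δsign m = twice (sign m)
  where
  twice : ∀ s → - + 1 * s - s ≡ - + 2 * s
  twice = solve-∀

Δ^sign : ∀ j m → Δ^ j sign m ≡ (- + 2) ^ j * sign m
Δ^sign zero    m = sym (*-identityˡ (sign m))
Δ^sign (suc j) m = begin
  Δ^ j (Δ sign) m                    ≡⟨ Δ^-cong j Δsign m ⟩
  Δ^ j (λ m → - + 2 * sign m) m      ≡⟨ Δ^-scale j (- + 2) sign m ⟩
  - + 2 * Δ^ j sign m                ≡⟨ cong (- + 2 *_) (Δ^sign j m) ⟩
  - + 2 * ((- + 2) ^ j * sign m)     ≡⟨ *-assoc (- + 2) ((- + 2) ^ j) (sign m) ⟨
  (- + 2) ^ suc j * sign m           ∎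

half : ℕ → ℤ
half m = + (m / 2)

parity : ℕ → ℤ
parity zero          = + 0
parity (suc zero)    = + 1
parity (suc (suc m)) = parity m

half-+2 : ∀ m → half (suc (suc m)) ≡ + 1 + half m
half-+2 m = cong +_ (m/n≡1+[m∸n]/n {suc (suc m)} (s≤s (s≤s z≤n)))

Δhalf≡parity : ∀ m → Δ half m ≡ parity m
Δhalf≡parity zero          = refl
Δhalf≡parity (suc zero)    = refl
Δhalf≡parity (suc (suc m)) = begin
  half (suc (suc (suc m))) - half (suc (suc m)) ≡⟨ cong₂ _-_ (half-+2 (suc m)) (half-+2 m) ⟩
  (+ 1 + half (suc m)) - (+ 1 + half m)         ≡⟨ cancel (half (suc m)) (half m) ⟩
  Δ half m                                      ≡⟨ Δhalf≡parity m ⟩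
  parity m                                      ∎
  where
  cancel : ∀ x y → (+ 1 + x) - (+ 1 + y) ≡ x - y
  cancel = solve-∀

Δparity≡sign : ∀ m → Δ parity m ≡ sign m
Δparity≡sign zero          = refl
Δparity≡sign (suc zero)    = refl
Δparity≡sign (suc (suc m)) = trans (Δparity≡sign m) (sign-+2 (sign m))
  where
  sign-+2 : ∀ s → s ≡ - + 1 * (- + 1 * s)
  sign-+2 = solve-∀

ΔΔhalf≡sign : ∀ m → Δ (Δ half) m ≡ sign m
ΔΔhalf≡sign m = trans (cong₂ _-_ (Δhalf≡parity (suc m)) (Δhalf≡parity m)) (Δparity≡sign m)

corollary12 : (k : ℕ) → 2 ≤ k → sumTo k (term k) ≡ (- + 2) ^ (k ∸ 2)
corollary12 (suc (suc j)) _ = begin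
  sumTo (suc (suc j)) (term (suc (suc j)))   ≡⟨⟩
  alternatingBinomialSum (suc (suc j)) half  ≡⟨ alternatingBinomialSum≡Δ^ (suc (suc j)) half ⟩
  Δ^ j (Δ (Δ half)) 0                        ≡⟨ Δ^-cong j ΔΔhalf≡sign 0 ⟩
  Δ^ j sign 0                                ≡⟨ Δ^sign j 0 ⟩
  (- + 2) ^ j * + 1                          ≡⟨ *-identityʳ _ ⟩
  (- + 2) ^ j                                ∎
corollary12 (suc zero) (s≤s ())
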